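{- The logic $\mathit{S5BKE}$ is complete with respect to frame-based semantics: for every set of formulas $\Phi\cup\{\varphi\}$, if $\Phi\Vdash_f\varphi$ then $\Phi\vdash\varphi$.
   Context: Language: formulas $Fm$ are built from propositional variables $V$ with $\neg,\rightarrow$ and unary operators $\square,K,B$; $\wedge,\vee,\leftrightarrow,\top,\bot$ are the usual abbreviations. Axioms of $\mathit{S5BKE}$ (all instances of): (i) every formula having the form of a classical propositional tautology; (ii) $K\varphi\rightarrow\varphi$; (iii) $K\varphi\rightarrow B\varphi$; (iv) $\square\varphi\rightarrow\square\square\varphi$; (v) $\neg\square\varphi\rightarrow\square\neg\square\varphi$; (vi) $\square\varphi\rightarrow K\varphi$; (vii) $K(\varphi\rightarrow\psi)\rightarrow(K\varphi\rightarrow K\psi)$; (viii) $B(\varphi\rightarrow\psi)\rightarrow(B\varphi\rightarrow B\psi)$; (ix) $\square(\varphi\rightarrow\psi)\rightarrow(\square\varphi\rightarrow\square\psi)$; (x) $\neg B\bot$. Rules: modus ponens, and axiom necessitation (if $\varphi$ is an axiom, infer $\square\varphi$). $\Phi\vdash\varphi$: derivability from premises $\Phi$ with these axioms and rules. Frames: $\mathcal{F}=(W,P,E_K,E_B,w_T)$ where $W$ is a nonempty set of worlds, $w_T\in W$, $P\subseteq\mathcal{P}(W)$ contains $\varnothing,W$ and is closed under $\cap$, $\cup$, complement $W\setminus A$, $KA:=\{w: A\in E_K(w)\}$ and $BA:=\{w: A\in E_B(w)\}$; each $E_K(w)\subseteq P$ is a filter on $P$ (nonempty, closed under finite intersections and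 supersets in $P$) with $A\in E_K(w)\Rightarrow w\in A$; each $E_B(w)\subseteq P$ is a proper filter on $P$ with $E_K(w)\subseteq E_B(w)$. A frame-based model is $\mathcal{K}=(\mathcal{F},g)$ with $g:V\to P$; $w\vDash x$ iff $w\in g(x)$; $\neg,\rightarrow$ classical; $w\vDash\square\varphi$ iff $w'\vDash\varphi$ for all $w'\in W$; $w\vDash K\varphi$ iff $\varphi^*\in E_K(w)$; $w\vDash B\varphi$ iff $\varphi^*\in E_B(w)$, where $\varphi^*=\{w: w\vDash\varphi\}$. $\mathcal{K}\vDash\varphi$ iff $w_T\vDash\varphi$. $\Phi\Vdash_f\varphi$ iff every frame-based model satisfying all of $\Phi$ satisfies $\varphi$. -}

module Defs where

open import Data.Nat using (ℕ)
open import Data.Bool using (Bool; true; false; not; _∨_)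
open import Data.Empty using (⊥)
open import Data.Unit using (⊤)
open import Data.Product using (Σ; ∃; _×_; _,_)
open import Data.Sum using (_⊎_)
open import Relation.Nullary using (¬_)
open import Relation.Binary.PropositionalEquality using (_≡_)

infixr 5 _⇒_
data Fm : Set where
  var : ℕ → Fm
  ~_  : Fm → Fm
  _⇒_ : Fm → Fm → Fm
  □_  : Fm → Fm
  K_  : Fm → Fm
  B_  : Fm → Fm

_∧'_ : Fm → Fm → Fm
φ ∧' ψ = ~ (φ ⇒ ~ ψ)

_∨'_ : Fm → Fm → Fm
φ ∨' ψ = ~ φ ⇒ ψ

_⇔'_ : Fm → Fm → Fm
φ ⇔' ψ = (φ ⇒ ψ) ∧' (ψ ⇒ φ)

⊤' : Fm
⊤' = var 0 ⇒ var 0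

⊥' : Fm
⊥' = ~ ⊤'

data PF : Set where
  pvar : ℕ → PF
  pneg : PF → PF
  pimp : PF → PF → PF

evalPF : (ℕ → Bool) → PF → Bool
evalPF v (pvar x)   = v x
evalPF v (pneg a)   = not (evalPF v a)
evalPF v (pimp a b) = not (evalPF v a) ∨ evalPF v b

Tautology : PF → Set
Tautology a = (v : ℕ → Bool) → evalPF v a ≡ true

substPF : (ℕ → Fm) → PF → Fm
substPF σ (pvar x)   = σ x
substPF σ (pneg a)   = ~ substPF σ a
substPF σ (pimp a b) = substPF σ a ⇒ substPF σ b

TautInstance : Fm → Set
TautInstance φ = Σ PF λ a → Σ (ℕ → Fm) λ σ → Tautology a × (φ ≡ substPF σ a)

data Axiom : Fm → Set where
  ax-taut : ∀ {φ} → TautInstance φ → Axiom φ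
  ax-KT   : ∀ φ → Axiom (K φ ⇒ φ)
  ax-KB   : ∀ φ → Axiom (K φ ⇒ B φ)
  ax-4    : ∀ φ → Axiom (□ φ ⇒ □ □ φ)
  ax-5    : ∀ φ → Axiom (~ □ φ ⇒ □ ~ □ φ)
  ax-□K   : ∀ φ → Axiom (□ φ ⇒ K φ)
  ax-distK : ∀ φ ψ → Axiom (K (φ ⇒ ψ) ⇒ (K φ ⇒ K ψ))
  ax-distB : ∀ φ ψ → Axiom (B (φ ⇒ ψ) ⇒ (B φ ⇒ B ψ))
  ax-dist□ : ∀ φ ψ → Axiom (□ (φ ⇒ ψ) ⇒ (□ φ ⇒ □ ψ))
  ax-D    : Axiom (~ B ⊥')

data _⊢_ (Φ : Fm → Set) : Fm → Set where
  premise : ∀ {φ} → Φ φ → Φ ⊢ φ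
  axiom   : ∀ {φ} → Axiom φ → Φ ⊢ φ
  mp      : ∀ {φ ψ} → Φ ⊢ (φ ⇒ ψ) → Φ ⊢ φ → Φ ⊢ ψ
  axnec   : ∀ {φ} → Axiom φ → Φ ⊢ (□ φ)

record Frame : Set₁ where
  field
    W   : Set
    P   : (W → Set) → Set
    EK  : W → (W → Set) → Set
    EB  : W → (W → Set) → Set
    wT  : W
    P-ext  : ∀ {A C} → P A → (∀ w → A w → C w) → (∀ w → C w → A w) → P C
    P-∅    : P (λ _ → ⊥)
    P-W    : P (λ _ → ⊤)
    P-∩    : ∀ {A C} → P A → P C → P (λ w → A w × C w)
    P-∪    : ∀ {A C} → P A → P C → P (λ w → A w ⊎ C w)
    P-c    : ∀ {A} → P A → P (λ w → ¬ A w)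
    P-K    : ∀ {A} → P A → P (λ w → EK w A)
    P-B    : ∀ {A} → P A → P (λ w → EB w A)
    EK⊆P   : ∀ {w A} → EK w A → P A
    EK-ne  : ∀ w → Σ (W → Set) λ A → EK w A
    EK-∩   : ∀ {w A C} → EK w A → EK w C → EK w (λ v → A v × C v)
    EK-up  : ∀ {w A C} → EK w A → P C → (∀ v → A v → C v) → EK w C
    EK-T   : ∀ {w A} → EK w A → A w
    EB⊆P   : ∀ {w A} → EB w A → P A
    EB-ne  : ∀ w → Σ (W → Set) λ A → EB w A
    EB-∩   : ∀ {w A C} → EB w A → EB w C → EB w (λ v → A v × C v)
    EB-up  : ∀ {w A C} → EB w A → P C → (∀ v → A v → C v) → EB w C
    EB-prop : ∀ {w} → ¬ EB w (λ _ → ⊥)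
    EK⊆EB  : ∀ {w A} → EK w A → EB w A

record Model : Set₁ where
  field
    frame : Frame
  open Frame frame public
  field
    g  : ℕ → W → Set
    gP : ∀ x → P (g x)

module _ (M : Model) where
  open Model M

  infix 4 _⊨_
  _⊨_ : W → Fm → Set
  w ⊨ var x   = g x w
  w ⊨ ~ φ     = ¬ (w ⊨ φ)
  w ⊨ (φ ⇒ ψ) = w ⊨ φ → w ⊨ ψ
  w ⊨ □ φ     = ∀ w' → w' ⊨ φ
  w ⊨ K φ     = EK w (λ v → v ⊨ φ)
  w ⊨ B φ     = EB w (λ v → v ⊨ φ)

_⊨M_ : Model → Fm → Set
M ⊨M φ = _⊨_ M (Model.wT M) φ

_⊩f_ : (Fm → Set) → Fm → Set₁
Φ ⊩f φ = (M : Model) → (∀ ψ → Φ ψ → M ⊨M ψ) → M ⊨M φ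

-- With excluded middle, Lindenbaum's lemma extends a
-- consistent set to a maximal consistent Γ. The worlds are the maximal consistent sets
-- containing every θ with □ θ ∈ Γ; by axioms 4 and 5 they all agree on □-formulas, so □ is
-- the universal modality. The admissible sets are those defined by a formula, and E_K(w)
-- (E_B(w)) collects the sets defined by some φ with K φ ∈ w (B φ ∈ w); since □ φ ⇒ K φ and
-- K φ ⇒ B φ, both operators respect equivalence over all worlds, which makes this independent
-- of the defining formula and yields the filter conditions. The truth lemma states that every
-- formula defines its own truth set, and KT, KB and D give factivity, E_K ⊆ E_B and properness.

module Submission where

open import Defs
open import Axiom.ExcludedMiddle using (ExcludedMiddle)
open import Axiom.DoubleNegationElimination using (em⇒dne)
open import Level using (0ℓ)

open import Data.Nat using (ℕ; zero; suc; _<ᵇ_; _≤_; _≤′_; ≤′-refl; ≤′-step; _⊔_)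
open import Data.Nat.Properties using (≤⇒≤′; m≤m⊔n; m≤n⊔m)
open import Data.Bool using (Bool; true; false; not; _∨_; _∧_; T)
open import Data.Bool.Properties using (T-∧; T-≡)
open import Data.Empty using (⊥-elim)
open import Data.Product using (Σ; ∃; _×_; _,_; proj₁; proj₂)
open import Data.Sum as Sum using (_⊎_; inj₁; inj₂)
open import Data.List using (List; []; _∷_; _++_; foldl; concatMap; cartesianProductWith)
open import Data.List.Membership.Propositional using (_∈_)
open import Data.List.Membership.Propositional.Properties
  using (∈-++⁺ˡ; ∈-++⁺ʳ; ∈-concatMap⁺; ∈-cartesianProductWith⁺)
open import Data.List.Relation.Unary.Any as Any using (here; there)
open import Function using (_∘_; const; id)
open import Function.Bundles using (_⇔_; mk⇔; Equivalence)
open import Relation.Nullary using (¬_; yes; no)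
open import Relation.Nullary.Decidable using (isYes; toWitness; fromWitness)
open import Relation.Binary.PropositionalEquality using (_≡_; refl; trans; cong; cong₂)
open import Relation.Unary using (Pred; _⊆_; _∪_; ｛_｝; ⋃)

open Equivalence using (to; from)

ternary : PF → Bool
ternary (pvar x)   = x <ᵇ 3
ternary (pneg a)   = ternary a
ternary (pimp a b) = ternary a ∧ ternary b

valuation₃ : Bool → Bool → Bool → ℕ → Bool
valuation₃ x y z 0 = x
valuation₃ x y z 1 = y
valuation₃ x y z _ = z

evalPF-ternary : ∀ v a → T (ternary a) → evalPF v a ≡ evalPF (valuation₃ (v 0) (v 1) (v 2)) a
evalPF-ternary v (pvar 0) _ = refl
evalPF-ternary v (pvar 1) _ = refl
evalPF-ternary v (pvar 2) _ = refl
evalPF-ternary v (pvar (suc (suc (suc _)))) ()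
evalPF-ternary v (pneg a) t = cong not (evalPF-ternary v a t)
evalPF-ternary v (pimp a b) t =
  cong₂ (λ x y → not x ∨ y) (evalPF-ternary v a (proj₁ (to T-∧ t))) (evalPF-ternary v b (proj₂ (to T-∧ t)))

∀ᵇ : (Bool → Bool) → Bool
∀ᵇ f = f true ∧ f false

∀ᵇ-sound : ∀ f → T (∀ᵇ f) → ∀ b → T (f b)
∀ᵇ-sound f t true  = proj₁ (to T-∧ t)
∀ᵇ-sound f t false = proj₂ (to T-∧ t)

valid₃ : PF → Bool
valid₃ a = ∀ᵇ λ x → ∀ᵇ λ y → ∀ᵇ λ z → evalPF (valuation₃ x y z) a

valid₃-sound : ∀ a → T (valid₃ a) → ∀ x y z → T (evalPF (valuation₃ x y z) a)
valid₃-sound a valid x y z =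
  ∀ᵇ-sound (λ z → evalPF (valuation₃ x y z) a)
    (∀ᵇ-sound (λ y → ∀ᵇ λ z → evalPF (valuation₃ x y z) a)
      (∀ᵇ-sound (λ x → ∀ᵇ λ y → ∀ᵇ λ z → evalPF (valuation₃ x y z) a) valid x) y) z

valid₃⇒tautology : ∀ a → T (ternary a) → T (valid₃ a) → Tautology a
valid₃⇒tautology a t valid v =
  trans (evalPF-ternary v a t) (to T-≡ (valid₃-sound a valid (v 0) (v 1) (v 2)))

assign₃ : Fm → Fm → Fm → ℕ → Fm
assign₃ φ ψ χ 0 = φ
assign₃ φ ψ χ 1 = ψ
assign₃ φ ψ χ _ = χ

taut₃ : (a : PF) {t : T (ternary a)} {valid : T (valid₃ a)} (φ ψ χ : Fm) →
        Axiom (substPF (assign₃ φ ψ χ) a)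
taut₃ a {t} {valid} φ ψ χ = ax-taut (a , assign₃ φ ψ χ , valid₃⇒tautology a t valid , refl)

p₀ p₁ p₂ : PF
p₀ = pvar 0
p₁ = pvar 1
p₂ = pvar 2

taut-K : ∀ φ ψ → Axiom (φ ⇒ ψ ⇒ φ)
taut-K φ ψ = taut₃ (pimp p₀ (pimp p₁ p₀)) φ ψ φ

taut-S : ∀ φ ψ χ → Axiom ((φ ⇒ ψ ⇒ χ) ⇒ (φ ⇒ ψ) ⇒ φ ⇒ χ)
taut-S = taut₃ (pimp (pimp p₀ (pimp p₁ p₂)) (pimp (pimp p₀ p₁) (pimp p₀ p₂)))

taut-refl : ∀ φ → Axiom (φ ⇒ φ)
taut-refl φ = taut₃ (pimp p₀ p₀) φ φ φ

taut-explode : ∀ φ ψ → Axiom (~ φ ⇒ φ ⇒ ψ)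
taut-explode φ ψ = taut₃ (pimp (pneg p₀) (pimp p₀ p₁)) φ ψ φ

taut-reductio : ∀ φ → Axiom ((~ φ ⇒ ⊥') ⇒ φ)
taut-reductio φ = taut₃ (pimp (pimp (pneg p₀) (pneg (pimp p₂ p₂))) p₀) φ φ (var 0)

taut-∧-intro : ∀ φ ψ → Axiom (φ ⇒ ψ ⇒ φ ∧' ψ)
taut-∧-intro φ ψ = taut₃ (pimp p₀ (pimp p₁ (pneg (pimp p₀ (pneg p₁))))) φ ψ φ

Theory : Set₁
Theory = Pred Fm 0ℓ

infixl 5 _,,_
_,,_ : Theory → Fm → Theory
X ,, φ = X ∪ ｛ φ ｝

⊢-mono : ∀ {X Y φ} → X ⊆ Y → X ⊢ φ → Y ⊢ φ
⊢-mono X⊆Y (premise p) = premise (X⊆Y p)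
⊢-mono X⊆Y (axiom a)   = axiom a
⊢-mono X⊆Y (mp d e)    = mp (⊢-mono X⊆Y d) (⊢-mono X⊆Y e)
⊢-mono X⊆Y (axnec a)   = axnec a

deduction : ∀ {X φ ψ} → (X ,, φ) ⊢ ψ → X ⊢ (φ ⇒ ψ)
deduction (premise (inj₁ p))    = mp (axiom (taut-K _ _)) (premise p)
deduction (premise (inj₂ refl)) = axiom (taut-refl _)
deduction (axiom a)             = mp (axiom (taut-K _ _)) (axiom a)
deduction (axnec a)             = mp (axiom (taut-K _ _)) (axnec a)
deduction (mp d e)              = mp (mp (axiom (taut-S _ _ _)) (deduction d)) (deduction e)

Consistent : Theory → Set
Consistent X = ¬ (X ⊢ ⊥')

reductio : ∀ {X φ} → (X ,, ~ φ) ⊢ ⊥' → X ⊢ φ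
reductio d = mp (axiom (taut-reductio _)) (deduction d)

successors : Fm → List Fm
successors φ = φ ∷ ~ φ ∷ □ φ ∷ K φ ∷ B φ ∷ []

formulas : ℕ → List Fm
formulas zero    = []
formulas (suc n) = var n ∷ concatMap successors (formulas n) ++ cartesianProductWith _⇒_ (formulas n) (formulas n)

∈-formulas-successor : ∀ {n φ} (f : Fm → Fm) → (∀ {ψ} → f ψ ∈ successors ψ) →
                       φ ∈ formulas n → f φ ∈ formulas (suc n)
∈-formulas-successor f f∈ φ∈ = there (∈-++⁺ˡ (∈-concatMap⁺ successors (Any.map (λ { refl → f∈ }) φ∈)))

⊆-chain : {F : ℕ → Theory} → (∀ {n} → F n ⊆ F (suc n)) → ∀ {m n} → m ≤ n → F m ⊆ F n
⊆-chain {F} step m≤n = go (≤⇒≤′ m≤n)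
  where
    go : ∀ {m n} → m ≤′ n → F m ⊆ F n
    go ≤′-refl       = id
    go (≤′-step m≤n) = step ∘ go m≤n

∈-formulas-mono : ∀ {m n} → m ≤ n → (_∈ formulas m) ⊆ (_∈ formulas n)
∈-formulas-mono = ⊆-chain (∈-formulas-successor id (here refl))

formulas-complete : ∀ φ → ∃ λ n → φ ∈ formulas n
formulas-complete (var x) = suc x , here refl
formulas-complete (~ φ) with formulas-complete φ
... | n , p = suc n , ∈-formulas-successor ~_ (there (here refl)) p
formulas-complete (□ φ) with formulas-complete φ
... | n , p = suc n , ∈-formulas-successor □_ (there (there (here refl))) p
formulas-complete (K φ) with formulas-complete φ
... | n , p = suc n , ∈-formulas-successor K_ (there (there (there (here refl)))) p
formulas-complete (B φ) with formulas-complete φ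
... | n , p = suc n , ∈-formulas-successor B_ (there (there (there (there (here refl))))) p
formulas-complete (φ ⇒ ψ) with formulas-complete φ | formulas-complete ψ
... | m , p | n , q = suc (m ⊔ n) , there (∈-++⁺ʳ (concatMap successors (formulas (m ⊔ n)))
  (∈-cartesianProductWith⁺ _⇒_ (∈-formulas-mono (m≤m⊔n m n) p) (∈-formulas-mono (m≤n⊔m m n) q)))

-- Maximal consistent sets, as Boolean predicates so that they form a small type

⟦_⟧ : (Fm → Bool) → Theory
⟦ Δ ⟧ φ = T (Δ φ)

record IsMaximalConsistent (Δ : Fm → Bool) : Set where
  field
    closed     : ∀ {φ} → ⟦ Δ ⟧ ⊢ φ → ⟦ Δ ⟧ φ
    consistent : ¬ ⟦ Δ ⟧ ⊥'
    complete   : ∀ φ → ⟦ Δ ⟧ φ ⊎ ⟦ Δ ⟧ (~ φ)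

  ∈-~ : ∀ {φ} → ⟦ Δ ⟧ (~ φ) ⇔ (¬ ⟦ Δ ⟧ φ)
  ∈-~ {φ} = mk⇔ (λ n p → consistent (closed (mp (mp (axiom (taut-explode φ ⊥')) (premise n)) (premise p)))) from~
    where
      from~ : ¬ ⟦ Δ ⟧ φ → ⟦ Δ ⟧ (~ φ)
      from~ ¬p with complete φ
      ... | inj₁ p = ⊥-elim (¬p p)
      ... | inj₂ n = n

  stable : ∀ {φ} → ¬ ¬ ⟦ Δ ⟧ φ → ⟦ Δ ⟧ φ
  stable {φ} ¬¬p with complete φ
  ... | inj₁ p = p
  ... | inj₂ n = ⊥-elim (¬¬p (to ∈-~ n))

  ∈-⇒ : ∀ {φ ψ} → ⟦ Δ ⟧ (φ ⇒ ψ) ⇔ (⟦ Δ ⟧ φ → ⟦ Δ ⟧ ψ)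
  ∈-⇒ {φ} {ψ} = mk⇔ (λ i p → closed (mp (premise i) (premise p))) from⇒
    where
      from⇒ : (⟦ Δ ⟧ φ → ⟦ Δ ⟧ ψ) → ⟦ Δ ⟧ (φ ⇒ ψ)
      from⇒ f with complete φ
      ... | inj₁ p = closed (mp (axiom (taut-K ψ φ)) (premise (f p)))
      ... | inj₂ n = closed (mp (axiom (taut-explode φ ψ)) (premise n))

  ∈-∧ : ∀ {φ ψ} → ⟦ Δ ⟧ (φ ∧' ψ) ⇔ (⟦ Δ ⟧ φ × ⟦ Δ ⟧ ψ)
  ∈-∧ = mk⇔
    (λ c → stable (λ ¬p → to ∈-~ c (from ∈-⇒ (⊥-elim ∘ ¬p)))
         , stable (λ ¬q → to ∈-~ c (from ∈-⇒ (const (from ∈-~ ¬q)))))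
    (λ (p , q) → from ∈-~ (λ i → to ∈-~ (to ∈-⇒ i p) q))

  ∈-∨ : ∀ {φ ψ} → ⟦ Δ ⟧ (φ ∨' ψ) ⇔ (⟦ Δ ⟧ φ ⊎ ⟦ Δ ⟧ ψ)
  ∈-∨ {φ} = mk⇔ to∨ λ
    { (inj₁ p) → from ∈-⇒ (λ n → ⊥-elim (to ∈-~ n p))
    ; (inj₂ q) → from ∈-⇒ (const q) }
    where
      to∨ : ∀ {ψ} → ⟦ Δ ⟧ (φ ∨' ψ) → ⟦ Δ ⟧ φ ⊎ ⟦ Δ ⟧ ψ
      to∨ d with complete φ
      ... | inj₁ p = inj₁ p
      ... | inj₂ n = inj₂ (to ∈-⇒ d n)

  ∈-theorem : ∀ {φ} → Axiom φ → ⟦ Δ ⟧ (□ φ)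
  ∈-theorem a = closed (axnec a)

module Lindenbaum (em : ExcludedMiddle 0ℓ) where

  decide : Theory → Fm → Theory
  decide X φ with em {(X ,, φ) ⊢ ⊥'}
  ... | yes _ = X ,, ~ φ
  ... | no  _ = X ,, φ

  decide-⊇ : ∀ X φ → X ⊆ decide X φ
  decide-⊇ X φ p with em {(X ,, φ) ⊢ ⊥'}
  ... | yes _ = inj₁ p
  ... | no  _ = inj₁ p

  decide-consistent : ∀ X φ → Consistent X → Consistent (decide X φ)
  decide-consistent X φ c with em {(X ,, φ) ⊢ ⊥'}
  ... | yes inc = λ inc~ → c (mp (deduction inc) (reductio inc~))
  ... | no  con = con

  decide-decides : ∀ X φ → decide X φ φ ⊎ decide X φ (~ φ)
  decide-decides X φ with em {(X ,, φ) ⊢ ⊥'}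
  ... | yes _ = inj₂ (inj₂ refl)
  ... | no  _ = inj₁ (inj₂ refl)

  extend : Theory → List Fm → Theory
  extend = foldl decide

  extend-⊇ : ∀ X l → X ⊆ extend X l
  extend-⊇ X []      p = p
  extend-⊇ X (φ ∷ l) p = extend-⊇ (decide X φ) l (decide-⊇ X φ p)

  extend-consistent : ∀ X l → Consistent X → Consistent (extend X l)
  extend-consistent X []      c = c
  extend-consistent X (φ ∷ l) c = extend-consistent (decide X φ) l (decide-consistent X φ c)

  extend-decides : ∀ X l {φ} → φ ∈ l → extend X l φ ⊎ extend X l (~ φ)
  extend-decides X (φ ∷ l) (here refl) with decide-decides X φ
  ... | inj₁ p = inj₁ (extend-⊇ (decide X φ) l p)
  ... | inj₂ n = inj₂ (extend-⊇ (decide X φ) l n)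
  extend-decides X (ψ ∷ l) (there φ∈l) = extend-decides (decide X ψ) l φ∈l

  stage : Theory → ℕ → Theory
  stage X zero    = X
  stage X (suc n) = extend (stage X n) (formulas n)

  limit : Theory → Theory
  limit X = ⋃ ℕ (stage X)

  stage-mono : ∀ X {m n} → m ≤ n → stage X m ⊆ stage X n
  stage-mono X = ⊆-chain {stage X} λ {n} → extend-⊇ (stage X n) (formulas n)

  compactness : ∀ X {φ} → limit X ⊢ φ → ∃ λ n → stage X n ⊢ φ
  compactness X (premise (n , p)) = n , premise p
  compactness X (axiom a)         = 0 , axiom a
  compactness X (axnec a)         = 0 , axnec a
  compactness X (mp d e) with compactness X d | compactness X e
  ... | m , d′ | n , e′ =
    m ⊔ n , mp (⊢-mono (stage-mono X (m≤m⊔n m n)) d′) (⊢-mono (stage-mono X (m≤n⊔m m n)) e′)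

  limit-consistent : ∀ X → Consistent X → Consistent (limit X)
  limit-consistent X c inc with compactness X inc
  ... | n , inc′ = stage-consistent n inc′
    where
      stage-consistent : ∀ n → Consistent (stage X n)
      stage-consistent zero    = c
      stage-consistent (suc n) = extend-consistent (stage X n) (formulas n) (stage-consistent n)

  limit-decides : ∀ X φ → limit X φ ⊎ limit X (~ φ)
  limit-decides X φ with formulas-complete φ
  ... | n , φ∈ with extend-decides (stage X n) (formulas n) φ∈
  ... | inj₁ p = inj₁ (suc n , p)
  ... | inj₂ q = inj₂ (suc n , q)

  lindenbaum : ∀ X → Consistent X → Σ (Fm → Bool) λ Δ → IsMaximalConsistent Δ × X ⊆ ⟦ Δ ⟧
  lindenbaum X c = Δ , record { closed = closed ; consistent = consistent ; complete = complete }
                     , λ p → fromWitness (0 , p)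
    where
      Δ : Fm → Bool
      Δ φ = isYes (em {limit X φ})
      Δ⊆limit : ⟦ Δ ⟧ ⊆ limit X
      Δ⊆limit = toWitness
      consistent : ¬ ⟦ Δ ⟧ ⊥'
      consistent p = limit-consistent X c (premise (Δ⊆limit p))
      closed : ∀ {φ} → ⟦ Δ ⟧ ⊢ φ → ⟦ Δ ⟧ φ
      closed {φ} d with limit-decides X φ
      ... | inj₁ p = fromWitness p
      ... | inj₂ n = ⊥-elim (limit-consistent X c
            (mp (mp (axiom (taut-explode φ ⊥')) (premise n)) (⊢-mono Δ⊆limit d)))
      complete : ∀ φ → ⟦ Δ ⟧ φ ⊎ ⟦ Δ ⟧ (~ φ)
      complete φ with limit-decides X φ
      ... | inj₁ p = inj₁ (fromWitness p)
      ... | inj₂ n = inj₂ (fromWitness n)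

module Canonical (em : ExcludedMiddle 0ℓ) (Γ : Fm → Bool) (Γ-mcs : IsMaximalConsistent Γ) where
  open Lindenbaum em
  open IsMaximalConsistent

  Necessary : Theory
  Necessary θ = ⟦ Γ ⟧ (□ θ)

  record World : Set where
    field
      theory     : Fm → Bool
      maximal    : IsMaximalConsistent theory
      necessary⊆ : Necessary ⊆ ⟦ theory ⟧

  open World

  infix 4 _∋_
  _∋_ : World → Fm → Set
  w ∋ φ = ⟦ theory w ⟧ φ

  Γʷ : World
  Γʷ = record { theory = Γ ; maximal = Γ-mcs ; necessary⊆ = λ □θ →
                closed Γ-mcs (mp (axiom (ax-KT _)) (mp (axiom (ax-□K _)) (premise □θ))) }

  necessary-closed : ∀ {θ} → Necessary ⊢ θ → Necessary θ
  necessary-closed (premise p) = p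
  necessary-closed (axiom a)   = closed Γ-mcs (axnec a)
  necessary-closed (mp d e)    = closed Γ-mcs
    (mp (mp (axiom (ax-dist□ _ _)) (premise (necessary-closed d))) (premise (necessary-closed e)))
  necessary-closed (axnec a)   = closed Γ-mcs (mp (axiom (ax-4 _)) (axnec a))

  □-rigid : ∀ w {θ} → w ∋ □ θ ⇔ Necessary θ
  □-rigid w {θ} = mk⇔ down (λ □θ → necessary⊆ w (closed Γ-mcs (mp (axiom (ax-4 θ)) (premise □θ))))
    where
      down : w ∋ □ θ → Necessary θ
      down □θ = stable Γ-mcs λ ¬□θ → to (∈-~ (maximal w))
        (necessary⊆ w (closed Γ-mcs (mp (axiom (ax-5 θ)) (premise (from (∈-~ Γ-mcs) ¬□θ))))) □θ

  □-intro : ∀ {θ} → (∀ w → w ∋ θ) → Necessary θ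
  □-intro {θ} valid = stable Γ-mcs λ ¬□θ →
    let Δ , Δ-mcs , Δ⊇ = lindenbaum (Necessary ,, ~ θ) (¬□θ ∘ necessary-closed ∘ reductio)
        w = record { theory = Δ ; maximal = Δ-mcs ; necessary⊆ = Δ⊇ ∘ inj₁ }
    in to (∈-~ Δ-mcs) (Δ⊇ (inj₂ refl)) (valid w)

  Defines : Fm → Pred World 0ℓ → Set
  Defines φ A = ∀ w → A w ⇔ w ∋ φ

  Definable : Pred World 0ℓ → Set
  Definable A = Σ Fm λ φ → Defines φ A

  defines-~ : ∀ {φ A} → Defines φ A → Defines (~ φ) (¬_ ∘ A)
  defines-~ d w = mk⇔ (λ ¬a → from (∈-~ (maximal w)) (¬a ∘ from (d w)))
                      (λ n → to (∈-~ (maximal w)) n ∘ to (d w))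

  defines-⇒ : ∀ {φ ψ A C} → Defines φ A → Defines ψ C → Defines (φ ⇒ ψ) (λ w → A w → C w)
  defines-⇒ dA dC w = mk⇔ (λ f → from (∈-⇒ (maximal w)) (to (dC w) ∘ f ∘ from (dA w)))
                           (λ i → from (dC w) ∘ to (∈-⇒ (maximal w)) i ∘ to (dA w))

  defines-∧ : ∀ {φ ψ A C} → Defines φ A → Defines ψ C → Defines (φ ∧' ψ) (λ w → A w × C w)
  defines-∧ dA dC w = mk⇔ (λ (a , c) → from (∈-∧ (maximal w)) (to (dA w) a , to (dC w) c))
                           (λ i → let p , q = to (∈-∧ (maximal w)) i in from (dA w) p , from (dC w) q)

  defines-∨ : ∀ {φ ψ A C} → Defines φ A → Defines ψ C → Defines (φ ∨' ψ) (λ w → A w ⊎ C w)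
  defines-∨ dA dC w = mk⇔ (from (∈-∨ (maximal w)) ∘ Sum.map (to (dA w)) (to (dC w)))
                           (Sum.map (from (dA w)) (from (dC w)) ∘ to (∈-∨ (maximal w)))

  defines-□ : ∀ {φ A} → Defines φ A → Defines (□ φ) (λ _ → ∀ v → A v)
  defines-□ d w = mk⇔ (λ all → from (□-rigid w) (□-intro (λ v → to (d v) (all v))))
                      (λ □φ v → from (d v) (necessary⊆ v (to (□-rigid w) □φ)))

  -- K and B are both normal operators above □, which is all the neighbourhood construction uses.
  module Neighbourhoods (O : Fm → Fm)
    (O-□    : ∀ w {θ} → w ∋ □ θ → w ∋ O θ)
    (O-dist : ∀ w {φ ψ} → w ∋ O (φ ⇒ ψ) → w ∋ O φ → w ∋ O ψ) where

    O-mono : ∀ w {φ ψ} → (∀ v → v ∋ φ → v ∋ ψ) → w ∋ O φ → w ∋ O ψ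
    O-mono w φ⊆ψ = O-dist w (O-□ w (from (□-rigid w) (□-intro λ v → from (∈-⇒ (maximal v)) (φ⊆ψ v))))

    E : World → Pred World 0ℓ → Set
    E w A = Σ Fm λ φ → Defines φ A × w ∋ O φ

    defines-E : ∀ {φ A} → Defines φ A → Defines (O φ) (λ w → E w A)
    defines-E {φ} d w = mk⇔ (λ (ψ , d′ , Oψ) → O-mono w (λ v → to (d v) ∘ from (d′ v)) Oψ)
                             (λ Oφ → φ , d , Oφ)

    E-definable : ∀ w {A} → E w A → Definable A
    E-definable _ (φ , d , _) = φ , d

    E-nonempty : ∀ w → Σ (Pred World 0ℓ) (E w)
    E-nonempty w = (_∋ ⊤') , ⊤' , (λ _ → mk⇔ id id) , O-□ w (∈-theorem (maximal w) (taut-refl (var 0)))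

    E-∩ : ∀ w {A C} → E w A → E w C → E w (λ v → A v × C v)
    E-∩ w (φ , dA , Oφ) (ψ , dC , Oψ) = φ ∧' ψ , defines-∧ dA dC ,
      O-dist w (O-dist w (O-□ w (∈-theorem (maximal w) (taut-∧-intro φ ψ))) Oφ) Oψ

    E-up : ∀ w {A C} → E w A → Definable C → (∀ v → A v → C v) → E w C
    E-up w (φ , dA , Oφ) (ψ , dC) A⊆C = ψ , dC , O-mono w (λ v → to (dC v) ∘ A⊆C v ∘ from (dA v)) Oφ

  open Neighbourhoods K_ (λ w □θ → closed (maximal w) (mp (axiom (ax-□K _)) (premise □θ)))
                         (λ w i p → closed (maximal w) (mp (mp (axiom (ax-distK _ _)) (premise i)) (premise p)))
    renaming (E to EK; defines-E to defines-EK; E-definable to EK-definable;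
              E-nonempty to EK-nonempty; E-∩ to EK-∩; E-up to EK-up)

  open Neighbourhoods B_ (λ w □θ → closed (maximal w) (mp (axiom (ax-KB _)) (mp (axiom (ax-□K _)) (premise □θ))))
                         (λ w i p → closed (maximal w) (mp (mp (axiom (ax-distB _ _)) (premise i)) (premise p)))
    renaming (E to EB; defines-E to defines-EB; E-definable to EB-definable;
              E-nonempty to EB-nonempty; E-∩ to EB-∩; E-up to EB-up; O-mono to B-mono)

  frame : Frame
  frame = record
    { W = World ; P = Definable ; EK = EK ; EB = EB ; wT = Γʷ
    ; P-ext  = λ (φ , d) A⊆C C⊆A → φ , λ w → mk⇔ (to (d w) ∘ C⊆A w) (A⊆C w ∘ from (d w))
    ; P-∅    = ⊥' , λ w → mk⇔ ⊥-elim (consistent (maximal w))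
    ; P-W    = ⊤' , λ w → mk⇔ (const (closed (maximal w) (axiom (taut-refl (var 0))))) (const _)
    ; P-∩    = λ (φ , dA) (ψ , dC) → φ ∧' ψ , defines-∧ dA dC
    ; P-∪    = λ (φ , dA) (ψ , dC) → φ ∨' ψ , defines-∨ dA dC
    ; P-c    = λ (φ , d) → ~ φ , defines-~ d
    ; P-K    = λ (φ , d) → K φ , defines-EK d
    ; P-B    = λ (φ , d) → B φ , defines-EB d
    ; EK⊆P   = λ {w} → EK-definable w
    ; EK-ne  = EK-nonempty
    ; EK-∩   = λ {w} → EK-∩ w
    ; EK-up  = λ {w} → EK-up w
    ; EK-T   = λ {w} (φ , d , Kφ) → from (d w) (closed (maximal w) (mp (axiom (ax-KT φ)) (premise Kφ)))
    ; EB⊆P   = λ {w} → EB-definable w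
    ; EB-ne  = EB-nonempty
    ; EB-∩   = λ {w} → EB-∩ w
    ; EB-up  = λ {w} → EB-up w
    ; EB-prop = λ {w} (φ , d , Bφ) → to (∈-~ (maximal w)) (closed (maximal w) (axiom ax-D))
                  (B-mono w (λ v p → ⊥-elim (from (d v) p)) Bφ)
    ; EK⊆EB  = λ {w} (φ , d , Kφ) → φ , d , closed (maximal w) (mp (axiom (ax-KB φ)) (premise Kφ))
    }

  model : Model
  model = record { frame = frame ; g = λ x w → w ∋ var x ; gP = λ x → var x , λ _ → mk⇔ id id }

  truth : ∀ φ → Defines φ (λ w → _⊨_ model w φ)
  truth (var x) w = mk⇔ id id
  truth (~ φ)   = defines-~ (truth φ)
  truth (φ ⇒ ψ) = defines-⇒ (truth φ) (truth ψ)
  truth (□ φ)   = defines-□ (truth φ)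
  truth (K φ)   = defines-EK (truth φ)
  truth (B φ)   = defines-EB (truth φ)

model-existence : ExcludedMiddle 0ℓ → ∀ X → Consistent X → Σ Model λ M → ∀ φ → X φ → M ⊨M φ
model-existence em X c =
  let Γ , Γ-mcs , X⊆Γ = Lindenbaum.lindenbaum em X c
      open Canonical em Γ Γ-mcs
  in model , λ φ p → from (truth φ Γʷ) (X⊆Γ p)

corollary3p14 : ExcludedMiddle 0ℓ → (Φ : Fm → Set) (φ : Fm) → Φ ⊩f φ → Φ ⊢ φ
corollary3p14 em Φ φ Φ⊩φ = em⇒dne em λ Φ⊬φ →
  let M , M⊨ = model-existence em (Φ ,, ~ φ) (Φ⊬φ ∘ reductio)
  in M⊨ (~ φ) (inj₂ refl) (Φ⊩φ M (λ ψ p → M⊨ ψ (inj₁ p)))
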